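{- Let $P(x)=a_nx^n+a_{n-1}x^{n-1}+\cdots+a_1x$ with integer coefficients $a_i\ge 0$, $a_n\neq 0$, $n>1$, and $\gcd(a_n,\dots,a_1)=1$. Let $(a,b)\in\mathbb{N}^2$. If $\gcd_P(a,b)=1$, then $(a,b)$ is $\mathcal{F}(a_n,\dots,a_1)$-visible.
   Context: $\mathbb{N}=\{1,2,3,\dots\}$. For $(a,b)\in\mathbb{N}^2$, $\gcd_P(a,b)=\max\{d\in\mathbb{N}: d\mid P(a),\ d\mid b\}$, i.e. $\gcd(P(a),b)$. The family $\mathcal{F}(a_n,\dots,a_1)$ is the set of curves $\{y=q(a_nx^n+\cdots+a_1x)\mid q\in\mathbb{Q}^+\}$. A point $(r,s)\in\mathbb{N}^2$ is $\mathcal{F}(a_n,\dots,a_1)$-visible if there is $q\in\mathbb{Q}^+$ with $s=qP(r)$ and there is no other point of $\mathbb{N}^2$ on the curve $y=qP(x)$ between the origin and $(r,s)$ (i.e. no $(x,y)\in\mathbb{N}^2$ with $0<x<r$ and $y=qP(x)$). -}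

module Defs where

open import Data.Nat using (ℕ; zero; suc; _+_; _*_; _^_; _<_)
open import Data.Nat.GCD using (gcd)
open import Data.Vec using (Vec; []; _∷_; foldr)
open import Data.Integer using (+_)
open import Data.Rational using (ℚ; _/_; Positive) renaming (_*_ to _*ℚ_)
open import Data.Product using (Σ; _×_)
open import Relation.Binary.PropositionalEquality using (_≡_)
open import Relation.Nullary using (¬_)

-- Coefficient vector cs = [a_1, a_2, ..., a_n] (index i ↦ coefficient of x^(i+1)).
-- evalFrom k [c_0,...,c_m] x = c_0 x^k + c_1 x^(k+1) + ... + c_m x^(k+m)
evalFrom : ∀ {n} → ℕ → Vec ℕ n → ℕ → ℕ
evalFrom k []       x = 0
evalFrom k (c ∷ cs) x = c * x ^ k + evalFrom (suc k) cs x

P : ∀ {n} → Vec ℕ n → ℕ → ℕ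
P cs x = evalFrom 1 cs x

leading : ∀ {n} → Vec ℕ n → ℕ
leading []           = 0
leading (c ∷ [])     = c
leading (c ∷ d ∷ cs) = leading (d ∷ cs)

gcdCoeffs : ∀ {n} → Vec ℕ n → ℕ
gcdCoeffs cs = foldr _ gcd 0 cs

gcdP : ∀ {n} → Vec ℕ n → ℕ → ℕ → ℕ
gcdP cs a b = gcd (P cs a) b

ℕ→ℚ : ℕ → ℚ
ℕ→ℚ m = (+ m) / 1

-- (r,s) is F(a_n,...,a_1)-visible: there is q ∈ ℚ⁺ with s = q P(r) and no
-- (x,y) ∈ ℕ² (ℕ = {1,2,...}) with 0 < x < r and y = q P(x).
Visible : ∀ {n} → Vec ℕ n → ℕ → ℕ → Set
Visible cs r s =
  Σ ℚ λ q → Positive q × (ℕ→ℚ s ≡ q *ℚ ℕ→ℚ (P cs r)) ×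
    ((x y : ℕ) → 0 < x → 0 < y → x < r → ¬ (ℕ→ℚ y ≡ q *ℚ ℕ→ℚ (P cs x)))

-- Take q = b / P(a). A lattice point (x, y) with 0 < x < a on y = q P(x) would
-- give y · P(a) = b · P(x); as b / P(a) is in lowest terms, b divides y, so
-- P(a) ≤ P(x), contradicting that P is strictly increasing.
module Submission where

open import Defs
open import Data.Nat using (ℕ; zero; suc; _*_; _<_; _≤_; z≤n; NonZero)
open import Data.Nat.Properties
open import Data.Nat.Divisibility using (_∣_; divides; ∣⇒≤)
open import Data.Nat.Coprimality as Coprimality using (Coprime; gcd≡1⇒coprime; coprime-divisor)
open import Data.Vec using (Vec; []; _∷_)
open import Data.Integer as ℤ using (+_)
import Data.Integer.Properties as ℤ
open import Data.Rational using (_/_; toℚᵘ) renaming (_*_ to _*ℚ_)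
open import Data.Rational.Properties using (toℚᵘ-cong; toℚᵘ-injective; toℚᵘ-homo-*; toℚᵘ-fromℚᵘ; normalize-pos)
open import Data.Rational.Unnormalised as ℚᵘ using (mkℚᵘ; *≡*)
import Data.Rational.Unnormalised.Properties as ℚᵘ
open import Data.Product using (_,_)
open import Data.Empty using (⊥-elim)
open import Function.Bundles using (_⇔_; mk⇔; Equivalence)
open import Relation.Nullary using (¬_)
open import Relation.Binary.PropositionalEquality using (_≡_; refl; sym; trans; cong; subst)

evalFrom-mono-≤ : ∀ {n} k (cs : Vec ℕ n) {x a} → x ≤ a → evalFrom k cs x ≤ evalFrom k cs a
evalFrom-mono-≤ k []       x≤a = z≤n
evalFrom-mono-≤ k (c ∷ cs) x≤a =
  +-mono-≤ (*-monoʳ-≤ c (^-monoˡ-≤ k x≤a)) (evalFrom-mono-≤ (suc k) cs x≤a)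

evalFrom-mono-< : ∀ {n} k (cs : Vec ℕ n) {x a} → ¬ (leading cs ≡ 0) →
                  x < a → evalFrom (suc k) cs x < evalFrom (suc k) cs a
evalFrom-mono-< k []               lead≢0 x<a = ⊥-elim (lead≢0 refl)
evalFrom-mono-< k (zero ∷ [])      lead≢0 x<a = ⊥-elim (lead≢0 refl)
evalFrom-mono-< k (c@(suc _) ∷ []) lead≢0 x<a =
  +-monoˡ-< 0 (*-monoʳ-< c (^-monoˡ-< (suc k) x<a))
evalFrom-mono-< k (c ∷ d ∷ cs)     lead≢0 x<a =
  +-mono-≤-< (*-monoʳ-≤ c (^-monoˡ-≤ (suc k) (<⇒≤ x<a)))
             (evalFrom-mono-< (suc k) (d ∷ cs) lead≢0 x<a)

P-mono-< : ∀ {n} (cs : Vec ℕ n) {x a} → ¬ (leading cs ≡ 0) → x < a → P cs x < P cs a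
P-mono-< = evalFrom-mono-< 0

ℕ→ℚ-≡-/-*-ℕ→ℚ : ∀ y b k p → (ℕ→ℚ y ≡ ((+ b) / suc k) *ℚ ℕ→ℚ p) ⇔ (y * suc k ≡ b * p)
ℕ→ℚ-≡-/-*-ℕ→ℚ y b k p = mk⇔
  (λ eq → cross-mul (ℚᵘ.≃-trans (ℚᵘ.≃-sym y≃) (ℚᵘ.≃-trans (toℚᵘ-cong eq) rhs≃)))
  (λ eq → toℚᵘ-injective (ℚᵘ.≃-trans y≃ (ℚᵘ.≃-trans (*≡* (cross-mul⁻¹ eq)) (ℚᵘ.≃-sym rhs≃))))
  where
  rhsᵘ : ℚᵘ.ℚᵘ
  rhsᵘ = mkℚᵘ (+ b) k ℚᵘ.* mkℚᵘ (+ p) 0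

  y≃ : toℚᵘ (ℕ→ℚ y) ℚᵘ.≃ mkℚᵘ (+ y) 0
  y≃ = toℚᵘ-fromℚᵘ (mkℚᵘ (+ y) 0)

  rhs≃ : toℚᵘ (((+ b) / suc k) *ℚ ℕ→ℚ p) ℚᵘ.≃ rhsᵘ
  rhs≃ = ℚᵘ.≃-trans (toℚᵘ-homo-* ((+ b) / suc k) (ℕ→ℚ p))
           (ℚᵘ.*-cong (toℚᵘ-fromℚᵘ (mkℚᵘ (+ b) k)) (toℚᵘ-fromℚᵘ (mkℚᵘ (+ p) 0)))

  lhs-pos : + y ℤ.* ℚᵘ.↧ rhsᵘ ≡ + (y * suc k)
  lhs-pos = trans (cong (λ t → + y ℤ.* + suc t) (*-identityʳ k)) (sym (ℤ.pos-* y (suc k)))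

  rhs-pos : ℚᵘ.↥ rhsᵘ ℤ.* + 1 ≡ + (b * p)
  rhs-pos = trans (ℤ.*-identityʳ (+ b ℤ.* + p)) (sym (ℤ.pos-* b p))

  cross-mul : mkℚᵘ (+ y) 0 ℚᵘ.≃ rhsᵘ → y * suc k ≡ b * p
  cross-mul (*≡* eq) = ℤ.+-injective (trans (sym lhs-pos) (trans eq rhs-pos))

  cross-mul⁻¹ : y * suc k ≡ b * p → + y ℤ.* ℚᵘ.↧ rhsᵘ ≡ ℚᵘ.↥ rhsᵘ ℤ.* + 1
  cross-mul⁻¹ eq = trans lhs-pos (trans (cong +_ eq) (sym rhs-pos))

coprime-cross-mul⇒≤ : ∀ {b d y p} .{{_ : NonZero b}} .{{_ : NonZero y}} →
                      Coprime d b → y * d ≡ b * p → d ≤ p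
coprime-cross-mul⇒≤ {b} {d} {y} {p} d⊥b yd≡bp = *-cancelˡ-≤ b (begin
  b * d  ≤⟨ *-monoˡ-≤ d (∣⇒≤ b∣y) ⟩
  y * d  ≡⟨ yd≡bp ⟩
  b * p  ∎)
  where
  open ≤-Reasoning
  b∣y : b ∣ y
  b∣y = coprime-divisor (Coprimality.sym d⊥b)
          (divides p (trans (*-comm d y) (trans yd≡bp (*-comm b p))))

lemma3p2 : (n : ℕ) (cs : Vec ℕ n) → 1 < n → ¬ (leading cs ≡ 0) →
           gcdCoeffs cs ≡ 1 →
           (a b : ℕ) → 0 < a → 0 < b → gcdP cs a b ≡ 1 → Visible cs a b
lemma3p2 _ cs _ lead≢0 _ a b@(suc _) 0<a _ gcd≡1 with P cs a in Pa≡d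
... | zero  = ⊥-elim (n≮0 (subst (P cs 0 <_) Pa≡d (P-mono-< cs lead≢0 0<a)))
... | suc k = (+ b) / suc k , normalize-pos b (suc k) ,
              Equivalence.from (ℕ→ℚ-≡-/-*-ℕ→ℚ b b k (suc k)) refl , no-point
  where
  no-point : (x y : ℕ) → 0 < x → 0 < y → x < a →
             ¬ (ℕ→ℚ y ≡ ((+ b) / suc k) *ℚ ℕ→ℚ (P cs x))
  no-point x y@(suc _) _ _ x<a on-curve =
    <⇒≱ (subst (P cs x <_) Pa≡d (P-mono-< cs lead≢0 x<a))
        (coprime-cross-mul⇒≤ {b = b} {y = y} (gcd≡1⇒coprime gcd≡1)
          (Equivalence.to (ℕ→ℚ-≡-/-*-ℕ→ℚ y b k (P cs x)) on-curve))
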